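{- Let $r\geq 3$ and let $L_r(n)$ be the orthogonal array graph of an orthogonal array $OA(r,n)$ corresponding to a set of $r-2$ mutually orthogonal Latin squares of order $n$. If this set of $r-2$ mutually orthogonal Latin squares can be extended to a complete set of $n-1$ mutually orthogonal Latin squares of order $n$, then $L_r(n)$ is a hull.
   Context: An $OA(r,n)$ is an $r\times n^2$ array with entries from an $n$-element set such that for any two rows, every ordered pair of entries appears in exactly one column. The orthogonal array graph $L_r(n)$ has as vertices the $n^2$ columns, two columns adjacent iff they have the same entry in some row. A set of $r-2$ mutually orthogonal Latin squares of order $n$ corresponds to an $OA(r,n)$ whose rows record, for each of the $n^2$ cells, the row index, the column index, and the symbol of the cell in each of the $r-2$ squares. Two Latin squares are orthogonal if, when superimposed, each of the $n^2$ ordered pairs of symbols occurs exactly once. For a set $M$ of transformations of the vertex set $V$ (acting on the right), $\mathrm{Gr}(M)$ is the graph on $V$ in which distinct $v,w$ are adjacent iff no $f\in M$ satisfies $vf=wf$; the hull of $X$ is $\mathrm{Hull}(X)=\mathrm{Gr}(\mathrm{End}(X))$, and $X$ is a hull if $X=\mathrm{Hull}(X)$. -}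

module Defs where

open import Data.Nat using (ℕ; _∸_)
open import Data.Fin using (Fin)
open import Data.Product using (Σ; _×_; _,_; ∃)
open import Relation.Binary.PropositionalEquality using (_≡_; _≢_)
open import Relation.Nullary using (¬_)
open import Function.Definitions using (Injective)

ExactlyOne : {A : Set} → (A → Set) → Set
ExactlyOne {A} P = Σ A λ x → P x × (∀ y → P y → x ≡ y)

Square : ℕ → Set
Square n = Fin n → Fin n → Fin n

IsLatin : {n : ℕ} → Square n → Set
IsLatin {n} L =
  (∀ (i s : Fin n) → ExactlyOne (λ j → L i j ≡ s)) ×
  (∀ (j s : Fin n) → ExactlyOne (λ i → L i j ≡ s))

Orthogonal : {n : ℕ} → Square n → Square n → Set
Orthogonal {n} L M =
  ∀ (a b : Fin n) → ExactlyOne (λ (c : Fin n × Fin n) →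
     let (i , j) = c in L i j ≡ a × M i j ≡ b)

IsMOLS : {n k : ℕ} → (Fin k → Square n) → Set
IsMOLS {n} {k} L =
  (∀ t → IsLatin (L t)) × (∀ t u → t ≢ u → Orthogonal (L t) (L u))

ExtendsToComplete : {n k : ℕ} → (Fin k → Square n) → Set
ExtendsToComplete {n} {k} L =
  Σ (Fin (n ∸ 1) → Square n) λ M → IsMOLS M ×
    Σ (Fin k → Fin (n ∸ 1)) λ ι → Injective _≡_ _≡_ ι ×
      (∀ t i j → L t i j ≡ M (ι t) i j)

-- columns of the OA(k+2, n) are the n² cells
Cell : ℕ → Set
Cell n = Fin n × Fin n

-- the OA(k+2,n) of the MOLS L: row 0 = row index, row 1 = column index,
-- row 2+t = symbol of square t.  Two columns agree in some row.
data AgreeSomeRow {n k : ℕ} (L : Fin k → Square n) : Cell n → Cell n → Set where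
  rowIdx : ∀ {i j i' j'} → i ≡ i' → AgreeSomeRow L (i , j) (i' , j')
  colIdx : ∀ {i j i' j'} → j ≡ j' → AgreeSomeRow L (i , j) (i' , j')
  sym    : ∀ {i j i' j'} (t : Fin k) → L t i j ≡ L t i' j' → AgreeSomeRow L (i , j) (i' , j')

OAAdj : {n k : ℕ} → (Fin k → Square n) → Cell n → Cell n → Set
OAAdj L v w = v ≢ w × AgreeSomeRow L v w

IsEndo : {V : Set} → (V → V → Set) → (V → V) → Set
IsEndo {V} Adj f = ∀ (v w : V) → Adj v w → Adj (f v) (f w)

HullAdj : {V : Set} → (V → V → Set) → V → V → Set
HullAdj {V} Adj v w =
  v ≢ w × ¬ (Σ (V → V) λ f → IsEndo Adj f × f v ≡ f w)

IsHull : {V : Set} → (V → V → Set) → Set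
IsHull {V} Adj =
  ∀ (v w : V) → (Adj v w → HullAdj Adj v w) × (HullAdj Adj v w → Adj v w)

module Submission where

-- Write X = L_{k+2}(n) for the graph of the OA(k+2,n) of k MOLS L, and
-- assume L extends to a complete set M of n-1 MOLS.  Adjacent vertices of
-- any loopless graph stay adjacent in Hull(X), since an endomorphism
-- cannot merge them; so X is a hull as soon as every pair of distinct
-- non-adjacent vertices is merged by some endomorphism (`hullCriterion`).
-- Two non-adjacent cells (i,j), (i',j') lie in different rows and columns.
-- A pigeonhole count (`completeSetCovers`) shows that some square M_s of
-- the complete set has equal symbols on them; M_s is not one of the L_t
-- (the cells agree in no square of L), so it is orthogonal to all of them
-- and hence properly colours X (`properColouring`).  Sending each cell to
-- the cell of row i with its M_s-colour maps X into a clique and is an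
-- endomorphism (`collapseEndo`) merging the two cells.

open import Defs
open import Data.Nat using (ℕ; _≤_; _∸_; suc; zero)
open import Data.Nat.Properties using (1+n≰n)
open import Data.Fin using (Fin; punchOut) renaming (zero to fzero; suc to fsuc)
open import Data.Fin.Properties using (_≟_; any?; punchOut-injective; injective⇒≤)
open import Data.Product using (Σ; ∃; _×_; _,_; proj₁; proj₂)
open import Data.Product.Properties using (≡-dec)
open import Data.Empty using (⊥; ⊥-elim)
open import Relation.Nullary using (¬_; Dec; yes; no)
open import Relation.Nullary.Decidable using (¬?; _×-dec_)
open import Relation.Binary.PropositionalEquality
  using (_≡_; _≢_; refl; trans; cong; module ≡-Reasoning) renaming (sym to ≡-sym)
open import Function.Definitions using (Injective)

unique : {A : Set} {P : A → Set} → ExactlyOne P → ∀ {a b} → P a → P b → a ≡ b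
unique (x , _ , only) {a} {b} pa pb = trans (≡-sym (only a pa)) (only b pb)

exactlyOne-resp : {A : Set} {P Q : A → Set} →
  (∀ x → P x → Q x) → (∀ x → Q x → P x) → ExactlyOne P → ExactlyOne Q
exactlyOne-resp P⇒Q Q⇒P (x , px , only) = x , P⇒Q x px , λ y qy → only y (Q⇒P y qy)

module _ {n : ℕ} where

  rowInjective : {S : Square n} → IsLatin S → ∀ {i j j'} → S i j ≡ S i j' → j ≡ j'
  rowInjective (rows , _) {i} {j} e = unique (rows i _) {j} refl (≡-sym e)

  columnInjective : {S : Square n} → IsLatin S → ∀ {i i' j} → S i j ≡ S i' j → i ≡ i'
  columnInjective (_ , columns) {i} {_} {j} e = unique (columns j _) {i} refl (≡-sym e)

  columnOf : {S : Square n} → IsLatin S → (i s : Fin n) → Σ (Fin n) λ j → S i j ≡ s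
  columnOf (rows , _) i s = let (j , e , _) = rows i s in j , e

  orthogonalInjective : {S T : Square n} → Orthogonal S T → ∀ {i j i' j'} →
    S i j ≡ S i' j' → T i j ≡ T i' j' → (i , j) ≡ (i' , j')
  orthogonalInjective {S} {T} ST {i} {j} eS eT =
    unique (ST (S i j) (T i j)) {i , j} (refl , refl) (≡-sym eS , ≡-sym eT)

  orthogonal-respʳ : {S T T' : Square n} → (∀ i j → T i j ≡ T' i j) →
    Orthogonal S T → Orthogonal S T'
  orthogonal-respʳ T≗T' ST a b = exactlyOne-resp
    (λ (i , j) (eS , eT) → eS , trans (≡-sym (T≗T' i j)) eT)
    (λ (i , j) (eS , eT') → eS , trans (T≗T' i j) eT')
    (ST a b)

-- Pigeonhole: an injection of m points into m+1 points cannot miss two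
-- distinct values (prepending one of them and punching out the other would
-- inject m+1 points into m).
noInjectionMissingTwo : {m : ℕ} {c : Fin m → Fin (suc m)} {j j' : Fin (suc m)} →
  j ≢ j' → Injective _≡_ _≡_ c → (∀ s → j ≢ c s) → (∀ s → j' ≢ c s) → ⊥
noInjectionMissingTwo {m} j≢j' c-inj j∉c j'∉c = 1+n≰n (injective⇒≤ F-inj)
  where
  F : Fin (suc m) → Fin m
  F fzero    = punchOut j≢j'
  F (fsuc s) = punchOut (j∉c s)

  F-inj : Injective _≡_ _≡_ F
  F-inj {fzero}  {fzero}  _ = refl
  F-inj {fzero}  {fsuc u} e = ⊥-elim (j'∉c u (punchOut-injective j≢j' (j∉c u) e))
  F-inj {fsuc s} {fzero}  e = ⊥-elim (j'∉c s (punchOut-injective j≢j' (j∉c s) (≡-sym e)))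
  F-inj {fsuc s} {fsuc u} e = cong fsuc (c-inj (punchOut-injective (j∉c s) (j∉c u) e))

-- For each
-- square s let c s be the column of row i' repeating the symbol at (i,j):
-- c never hits j (column Latin), c is injective (orthogonality), so by
-- pigeonhole it must hit j'.
completeSetCovers : {m : ℕ} (M : Fin m → Square (suc m)) → IsMOLS M →
  ∀ {i j i' j'} → i ≢ i' → j ≢ j' → ∃ λ s → M s i j ≡ M s i' j'
completeSetCovers {m} M (latin , orth) {i} {j} {i'} {j'} i≢i' j≢j'
  with any? (λ s → M s i j ≟ M s i' j')
... | yes hit = hit
... | no miss = ⊥-elim (noInjectionMissingTwo j≢j' c-inj j∉c j'∉c)
  where
  c : Fin m → Fin (suc m)
  c s = proj₁ (columnOf (latin s) i' (M s i j))

  c-repeats : ∀ s → M s i' (c s) ≡ M s i j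
  c-repeats s = proj₂ (columnOf (latin s) i' (M s i j))

  repeatsAt : ∀ s {z} → z ≡ c s → M s i' z ≡ M s i j
  repeatsAt s refl = c-repeats s

  j∉c : ∀ s → j ≢ c s
  j∉c s j≡c = i≢i' (columnInjective (latin s) (≡-sym (repeatsAt s j≡c)))

  j'∉c : ∀ s → j' ≢ c s
  j'∉c s j'≡c = miss (s , ≡-sym (repeatsAt s j'≡c))

  c-inj : Injective _≡_ _≡_ c
  c-inj {s} {u} e with s ≟ u
  ... | yes s≡u = s≡u
  ... | no s≢u  = ⊥-elim (i≢i' (cong proj₁ (orthogonalInjective (orth s u s≢u)
          (≡-sym (c-repeats s)) (≡-sym (repeatsAt u e)))))

hullCriterion : {V : Set} (Adj : V → V → Set) →
  (∀ {v w} → Adj v w → v ≢ w) → (∀ v w → Dec (Adj v w)) →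
  (∀ v w → v ≢ w → ¬ Adj v w → Σ (V → V) λ f → IsEndo Adj f × f v ≡ f w) →
  IsHull Adj
hullCriterion Adj loopless adj? merge v w = adjacent⇒hull , hull⇒adjacent
  where
  adjacent⇒hull : Adj v w → HullAdj Adj v w
  adjacent⇒hull vw = loopless vw , λ (f , endo , fv≡fw) → loopless (endo v w vw) fv≡fw

  hull⇒adjacent : HullAdj Adj v w → Adj v w
  hull⇒adjacent (v≢w , unmerged) with adj? v w
  ... | yes vw = vw
  ... | no ¬vw = ⊥-elim (unmerged (merge v w v≢w ¬vw))

module _ {n k : ℕ} (L : Fin k → Square n) where

  agree? : (v w : Cell n) → Dec (AgreeSomeRow L v w)
  agree? (i , j) (i' , j') with i ≟ i' | j ≟ j' | any? (λ t → L t i j ≟ L t i' j')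
  ... | yes i≡i' | _        | _            = yes (rowIdx i≡i')
  ... | no _     | yes j≡j' | _            = yes (colIdx j≡j')
  ... | no _     | no _     | yes (t , e)  = yes (sym t e)
  ... | no i≢i'  | no j≢j'  | no none      =
    no λ { (rowIdx e) → i≢i' e ; (colIdx e) → j≢j' e ; (sym t e) → none (t , e) }

  oaAdj? : (v w : Cell n) → Dec (OAAdj L v w)
  oaAdj? v w = ¬? (≡-dec _≟_ _≟_ v w) ×-dec agree? v w

  properColouring : {S : Square n} → IsLatin S → (∀ t → Orthogonal S (L t)) →
    ∀ {a b a' b'} → OAAdj L (a , b) (a' , b') → S a b ≢ S a' b'
  properColouring latin _ (v≢w , rowIdx refl) e = v≢w (cong (_ ,_) (rowInjective latin e))
  properColouring latin _ (v≢w , colIdx refl) e = v≢w (cong (_, _) (columnInjective latin e))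
  properColouring _ orth (v≢w , sym t eL) e = v≢w (orthogonalInjective (orth t) e eL)

  -- Sending each cell to the cell of row i₀ bearing its colour is an
  -- endomorphism when the colouring is proper, since row i₀ is a clique.
  collapseEndo : (χ : Cell n → Fin n) → (∀ {v w} → OAAdj L v w → χ v ≢ χ w) →
    (i₀ : Fin n) → IsEndo (OAAdj L) (λ v → i₀ , χ v)
  collapseEndo χ proper i₀ v w vw = (λ e → proper vw (cong proj₂ e)) , rowIdx refl

-- If L extends to a complete set M, two distinct non-adjacent cells are
-- merged by an endomorphism: take a square M_s with equal symbols on them;
-- it lies outside L, hence is orthogonal to every L_t, and collapsing along
-- its colouring onto the row of the first cell identifies the two cells.
mergeNonAdjacent : {n k : ℕ} (L : Fin k → Square n) → ExtendsToComplete L →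
  ∀ v w → v ≢ w → ¬ OAAdj L v w →
  Σ (Cell n → Cell n) λ f → IsEndo (OAAdj L) f × f v ≡ f w
mergeNonAdjacent {zero} _ _ (() , _) _ _ _
mergeNonAdjacent {suc m} L (M , (latin , orth) , ι , _ , L≗M) (i , j) (i' , j') v≢w ¬adj =
  collapse , collapseEndo L colour properM i , cong (i ,_) s-agrees
  where
  disagree : ¬ AgreeSomeRow L (i , j) (i' , j')
  disagree ag = ¬adj (v≢w , ag)

  covered : ∃ λ s → M s i j ≡ M s i' j'
  covered = completeSetCovers M (latin , orth)
    (λ e → disagree (rowIdx e)) (λ e → disagree (colIdx e))

  s : Fin m
  s = proj₁ covered

  s-agrees : M s i j ≡ M s i' j'
  s-agrees = proj₂ covered

  -- M_s is none of the squares of L, since those separate the two cells.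
  s-outside : ∀ t → s ≢ ι t
  s-outside t s≡ιt = disagree (sym t (begin
    L t i j          ≡⟨ L≗M t i j ⟩
    M (ι t) i j      ≡⟨ cong (λ u → M u i j) (≡-sym s≡ιt) ⟩
    M s i j          ≡⟨ s-agrees ⟩
    M s i' j'        ≡⟨ cong (λ u → M u i' j') s≡ιt ⟩
    M (ι t) i' j'    ≡⟨ ≡-sym (L≗M t i' j') ⟩
    L t i' j'        ∎))
    where open ≡-Reasoning

  orthToL : ∀ t → Orthogonal (M s) (L t)
  orthToL t = orthogonal-respʳ (λ a b → ≡-sym (L≗M t a b)) (orth s (ι t) (s-outside t))

  colour : Cell (suc m) → Fin (suc m)
  colour (a , b) = M s a b

  properM : ∀ {v w} → OAAdj L v w → colour v ≢ colour w
  properM = properColouring L (latin s) orthToL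

  collapse : Cell (suc m) → Cell (suc m)
  collapse v = i , colour v

-- Theorem 10.  If r-2 MOLS of order n extend to a complete set of n-1 MOLS,
-- the orthogonal array graph L_r(n) is a hull.
mainTheorem10 : (r n : ℕ) → 3 ≤ r → (L : Fin (r ∸ 2) → Square n) →
    IsMOLS L → ExtendsToComplete L → IsHull (OAAdj L)
mainTheorem10 r n _ L _ extends =
  hullCriterion (OAAdj L) proj₁ (oaAdj? L) (mergeNonAdjacent L extends)
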